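{- Let $S_n$ be the star graph on $n\ge 3$ vertices and let $t,r$ be integers with $t=r>2$. Then $\mathcal{D}_{t,r}(S_n)=[2,n]$.
   Context: The star $S_n$ consists of one central vertex adjacent to $n-1$ leaves. An orientation assigns to every edge exactly one direction. For vertices $u,v$ of an oriented graph, $d(u,v)$ is the minimum length of a directed path from $u$ to $v$ ($d(u,u)=0$; $\infty$ if none exists). Given positive integers $t,r$ and $S\subseteq V$, the directed reception at $w$ is $\vec{r}(w)=\sum_{v\in S,\ d(v,w)<t}(t-d(v,w))$; $S$ is a directed $(t,r)$ broadcast dominating set if $\vec{r}(w)\ge r$ for every vertex $w$, and $\gamma_{t,r}(\vec{G})$ is its minimum cardinality. $\mathcal{D}_{t,r}(G)$ is the integer interval $[d,D]$ where $d$ and $D$ are the minimum and maximum of $\gamma_{t,r}(\vec{G})$ over all orientations $\vec{G}$ of $G$. -}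

module Defs where

open import Data.Nat using (ℕ; zero; suc; _+_; _∸_; _≤_)
open import Data.Bool using (Bool; true; false; not; _∧_; _∨_; if_then_else_)
open import Data.Fin using (Fin; zero; suc)
open import Data.Fin.Subset using (Subset; ∣_∣)
open import Data.Vec using (lookup)
open import Data.Fin.Properties using () renaming (_≟_ to _≟ᶠ_)
open import Data.Maybe using (Maybe; just; nothing)
open import Data.Product using (Σ; _×_)
open import Relation.Nullary.Decidable using (⌊_⌋)

OrientedGraph : ℕ → Set
OrientedGraph N = Fin N → Fin N → Bool

-- The star S_(suc m): centre = zero, leaves = suc i (i : Fin m).
-- An orientation picks a direction for each of its m edges:
--   o i = true  : centre → leaf (suc i)
--   o i = false : leaf (suc i) → centre

StarOrientation : ℕ → Set
StarOrientation m = Fin m → Bool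

starArc : ∀ {m} → StarOrientation m → OrientedGraph (suc m)
starArc o zero    zero    = false
starArc o zero    (suc j) = o j
starArc o (suc i) zero    = not (o i)
starArc o (suc i) (suc j) = false

anyFin : ∀ {N} → (Fin N → Bool) → Bool
anyFin {zero}  f = false
anyFin {suc N} f = f zero ∨ anyFin (λ i → f (suc i))

sumFin : ∀ {N} → (Fin N → ℕ) → ℕ
sumFin {zero}  f = 0
sumFin {suc N} f = f zero + sumFin (λ i → f (suc i))

reach : ∀ {N} → OrientedGraph N → ℕ → Fin N → Fin N → Bool
reach G zero    u w = ⌊ u ≟ᶠ w ⌋
reach G (suc k) u w = reach G k u w ∨ anyFin (λ x → reach G k u x ∧ G x w)

distFrom : ∀ {N} → OrientedGraph N → Fin N → Fin N → ℕ → ℕ → Maybe ℕ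
distFrom G u w k zero       = nothing
distFrom G u w k (suc fuel) =
  if reach G k u w then just k else distFrom G u w (suc k) fuel

-- d(u,w): length of a shortest directed path from u to w; nothing = ∞.
-- (A shortest path in a graph with N vertices has length < N, so
--  searching k = 0, …, N-1 suffices.)
dist : ∀ {N} → OrientedGraph N → Fin N → Fin N → Maybe ℕ
dist {N} G u w = distFrom G u w 0 N

signal : ℕ → Maybe ℕ → ℕ
signal t (just d) = t ∸ d
signal t nothing  = 0

reception : ∀ {N} → OrientedGraph N → ℕ → Subset N → Fin N → ℕ
reception G t S w =
  sumFin (λ v → if lookup S v then signal t (dist G v w) else 0)

IsBroadcastDominating : ∀ {N} → OrientedGraph N → ℕ → ℕ → Subset N → Set
IsBroadcastDominating G t r S = ∀ w → r ≤ reception G t S w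

IsBroadcastDomNumber : ∀ {N} → OrientedGraph N → ℕ → ℕ → ℕ → Set
IsBroadcastDomNumber G t r k =
  Σ (Subset _) (λ S → IsBroadcastDominating G t r S × ∣ S ∣ ≡ k)
  × (∀ S → IsBroadcastDominating G t r S → k ≤ ∣ S ∣)
  where open import Relation.Binary.PropositionalEquality using (_≡_)

-- 𝒟_{t,r}(S_(suc m)) = [d , D]: every orientation has a well-defined
-- γ_{t,r} lying in [d,D], and both d and D are attained.

StarDomInterval : ℕ → ℕ → ℕ → ℕ → ℕ → Set
StarDomInterval m t r d D =
  (∀ (o : StarOrientation m) →
     Σ ℕ (λ k → IsBroadcastDomNumber (starArc o) t r k × d ≤ k × k ≤ D))
  × Σ (StarOrientation m) (λ o → IsBroadcastDomNumber (starArc o) t r d)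
  × Σ (StarOrientation m) (λ o → IsBroadcastDomNumber (starArc o) t r D)

-- A vertex of S receives t from itself, while a vertex outside S is at distance ≥ 1 from
-- every broadcaster and so receives at most (t - 1)|S|; hence every (t,t) dominating set
-- has at least two elements, and the whole vertex set is one. The value 2 is attained by
-- directing one leaf into the centre and the centre out to the other leaves, which then
-- receive (t - 1) + (t - 2) ≥ t. The value n is attained by directing every edge out of the
-- centre: nobody reaches the centre and only the centre reaches a leaf, so a vertex outside
-- S would receive at most t - 1.
module Submission where

open import Defs
open import Data.Nat using (ℕ; suc; _≤_; _<_)
open import Relation.Binary.PropositionalEquality using (_≡_)

open import Function using (_∘_)
open import Data.Nat using (zero; _+_; _*_; _∸_; z≤n; s≤s; _≤?_)
open import Data.Nat.Properties
open import Data.Nat.Induction using (<-wellFounded)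
open import Induction.WellFounded using (Acc; acc)
open import Data.Bool using (Bool; true; false; _∧_; _∨_; if_then_else_)
open import Data.Bool.Properties using (∨-zeroʳ; ∧-zeroʳ; ¬-not) renaming (_≟_ to _≟ᵇ_)
open import Data.Fin using (Fin; zero; suc)
open import Data.Fin.Properties using (all?; ¬∀⟶∃¬) renaming (_≟_ to _≟ᶠ_; suc-injective to fin-suc-injective)
open import Data.Fin.Subset using (Subset; ∣_∣; ⊤; ⊥; inside)
open import Data.Fin.Subset.Properties using (∣⊤∣≡n; ∣⊥∣≡0; anySubset?; p⊆q⇒∣p∣≤∣q∣)
open import Data.Vec using ([]; _∷_; lookup)
open import Data.Vec.Properties using (lookup-replicate; lookup⇒[]=)
open import Data.Maybe using (just; nothing)
open import Data.Product using (Σ; ∃; _×_; _,_)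
open import Relation.Nullary using (Dec; yes; no; ¬_; contradiction)
open import Relation.Nullary.Decidable using (_×-dec_; ⌊_⌋; isYes≗does; dec-true; dec-false)
open import Relation.Unary using (Pred; Decidable)
open import Relation.Binary.PropositionalEquality using (refl; cong; cong₂; sym; trans; subst; _≢_)

⌊⌋-true : ∀ {A : Set} (a? : Dec A) → A → ⌊ a? ⌋ ≡ true
⌊⌋-true a? a = trans (isYes≗does a?) (dec-true a? a)

⌊⌋-false : ∀ {A : Set} (a? : Dec A) → ¬ A → ⌊ a? ⌋ ≡ false
⌊⌋-false a? ¬a = trans (isYes≗does a?) (dec-false a? ¬a)

least-witness : ∀ {ℓ} {P : Pred ℕ ℓ} → Decidable P → ∀ {n} → Acc _<_ n → P n →
  ∃ λ k → P k × (∀ j → P j → k ≤ j)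
least-witness P? {n} (acc below) pn with anyUpTo? P? n
... | yes (j , j<n , pj) = least-witness P? (below j<n) pj
... | no none            = n , pn , λ j pj → ≮⇒≥ (λ j<n → none (j , j<n , pj))

m≤[m∸1]*n⇒2≤n : ∀ {m n} → 0 < m → m ≤ (m ∸ 1) * n → 2 ≤ n
m≤[m∸1]*n⇒2≤n {suc m} {zero}        _ h = contradiction (≤-trans h (≤-reflexive (*-zeroʳ m))) λ ()
m≤[m∸1]*n⇒2≤n {suc m} {suc zero}    _ h = contradiction (≤-trans h (≤-reflexive (*-identityʳ m))) (<-irrefl refl)
m≤[m∸1]*n⇒2≤n {suc m} {suc (suc n)} _ _ = s≤s (s≤s z≤n)

m≤[m∸1]+[m∸2] : ∀ {m} → 2 < m → m ≤ (m ∸ 1) + (m ∸ 2)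
m≤[m∸1]+[m∸2] {suc (suc (suc m))} _ = s≤s (s≤s (m≤n+m (suc m) m))
m≤[m∸1]+[m∸2] {suc (suc zero)} (s≤s (s≤s ()))
m≤[m∸1]+[m∸2] {suc zero}       (s≤s ())

∀∈⇒n≤∣p∣ : ∀ {n} (p : Subset n) → (∀ x → lookup p x ≡ true) → n ≤ ∣ p ∣
∀∈⇒n≤∣p∣ {n} p all∈ =
  subst (_≤ ∣ p ∣) (∣⊤∣≡n n) (p⊆q⇒∣p∣≤∣q∣ {p = ⊤} (λ {x} _ → lookup⇒[]= x p (all∈ x)))

anyFin-true : ∀ {N} {f : Fin N → Bool} x → f x ≡ true → anyFin f ≡ true
anyFin-true {f = f} zero    fx rewrite fx = refl
anyFin-true {f = f} (suc x) fx rewrite anyFin-true {f = f ∘ suc} x fx = ∨-zeroʳ (f zero)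

anyFin-false : ∀ {N} {f : Fin N → Bool} → (∀ x → f x ≡ false) → anyFin f ≡ false
anyFin-false {zero}          _       = refl
anyFin-false {suc N} {f} f≡false rewrite f≡false zero = anyFin-false (f≡false ∘ suc)

sumFin-≥ : ∀ {N} (f : Fin N → ℕ) v → f v ≤ sumFin f
sumFin-≥ f zero    = m≤m+n _ _
sumFin-≥ f (suc v) = ≤-trans (sumFin-≥ (f ∘ suc) v) (m≤n+m _ (f zero))

sumFin-≡0 : ∀ {N} (f : Fin N → ℕ) → (∀ v → f v ≡ 0) → sumFin f ≡ 0
sumFin-≡0 {zero}  f _ = refl
sumFin-≡0 {suc N} f h rewrite h zero = sumFin-≡0 (f ∘ suc) (h ∘ suc)

sumFin-single : ∀ {N} (f : Fin N → ℕ) c → (∀ v → v ≢ c → f v ≡ 0) → sumFin f ≡ f c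
sumFin-single f zero h
  rewrite sumFin-≡0 (f ∘ suc) (λ v → h (suc v) λ ()) = +-identityʳ (f zero)
sumFin-single f (suc c) h
  rewrite h zero (λ ()) = sumFin-single (f ∘ suc) c (λ v v≢c → h (suc v) (v≢c ∘ fin-suc-injective))

sumFin-≤-*∣∣ : ∀ {N} (S : Subset N) (f : Fin N → ℕ) c →
  (∀ v → f v ≤ (if lookup S v then c else 0)) → sumFin f ≤ c * ∣ S ∣
sumFin-≤-*∣∣ []          f c h = z≤n
sumFin-≤-*∣∣ (true ∷ S)  f c h =
  subst (sumFin f ≤_) (sym (*-suc c ∣ S ∣))
    (+-mono-≤ (h zero) (sumFin-≤-*∣∣ S (f ∘ suc) c (h ∘ suc)))
sumFin-≤-*∣∣ (false ∷ S) f c h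
  rewrite n≤0⇒n≡0 (h zero) = sumFin-≤-*∣∣ S (f ∘ suc) c (h ∘ suc)

dist-refl : ∀ {N} (G : OrientedGraph N) u → dist G u u ≡ just 0
dist-refl {suc N} G u rewrite ⌊⌋-true (u ≟ᶠ u) refl = refl

signal-dist-≤-pred : ∀ {N} (G : OrientedGraph N) t {u w} → u ≢ w → signal t (dist G u w) ≤ t ∸ 1
signal-dist-≤-pred {suc N} G t {u} {w} u≢w rewrite ⌊⌋-false (u ≟ᶠ w) u≢w = later 0 N
  where
  later : ∀ i fuel → signal t (distFrom G u w (suc i) fuel) ≤ t ∸ 1
  later i zero = z≤n
  later i (suc fuel) with reach G (suc i) u w
  ... | true  = ∸-monoʳ-≤ t (s≤s z≤n)
  ... | false = later (suc i) fuel

module _ {N : ℕ} (G : OrientedGraph N) where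

  Unreachable : Fin N → Fin N → Set
  Unreachable u w = ∀ k → reach G k u w ≡ false

  reach-refl : ∀ u → reach G 0 u u ≡ true
  reach-refl u = ⌊⌋-true (u ≟ᶠ u) refl

  reach-step : ∀ k u x w → reach G k u x ≡ true → G x w ≡ true → reach G (suc k) u w ≡ true
  reach-step k u x w u⇝x x→w =
    trans (cong (reach G k u w ∨_) (anyFin-true x (cong₂ _∧_ u⇝x x→w))) (∨-zeroʳ _)

  reach⇒signal-dist-≥ : ∀ t k u w → reach G k u w ≡ true → k < N → t ∸ k ≤ signal t (dist G u w)
  reach⇒signal-dist-≥ t k u w u⇝w k<N = search 0 N z≤n k<N
    where
    search : ∀ i fuel → i ≤ k → k < i + fuel → t ∸ k ≤ signal t (distFrom G u w i fuel)
    search i zero i≤k k<i+0 = contradiction i≤k (<⇒≱ (subst (k <_) (+-identityʳ i) k<i+0))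
    search i (suc fuel) i≤k k<i+fuel with reach G i u w in u⇝ᵢw
    ... | true  = ∸-monoʳ-≤ t i≤k
    ... | false = search (suc i) fuel (≤∧≢⇒< i≤k i≢k) (subst (k <_) (+-suc i fuel) k<i+fuel)
      where
      i≢k : i ≢ k
      i≢k refl = contradiction (trans (sym u⇝ᵢw) u⇝w) λ ()

  unreachable⇒dist≡nothing : ∀ {u w} → Unreachable u w → dist G u w ≡ nothing
  unreachable⇒dist≡nothing {u} {w} u↛w = search 0 N
    where
    search : ∀ i fuel → distFrom G u w i fuel ≡ nothing
    search i zero = refl
    search i (suc fuel) rewrite u↛w i = search (suc i) fuel

  contribution : ℕ → Subset N → Fin N → Fin N → ℕ
  contribution t S w v = if lookup S v then signal t (dist G v w) else 0

  contribution-∉ : ∀ t S {w v} → lookup S v ≡ false → contribution t S w v ≡ 0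
  contribution-∉ t S v∉S rewrite v∉S = refl

  contribution-unreachable : ∀ t S {w v} → Unreachable v w → contribution t S w v ≡ 0
  contribution-unreachable t S {w} {v} v↛w rewrite unreachable⇒dist≡nothing v↛w with lookup S v
  ... | true  = refl
  ... | false = refl

  contribution-outside-≤ : ∀ t S {w} → lookup S w ≡ false →
    ∀ v → contribution t S w v ≤ (if lookup S v then t ∸ 1 else 0)
  contribution-outside-≤ t S {w} w∉S v with v ≟ᶠ w
  ... | yes refl rewrite w∉S = z≤n
  ... | no v≢w with lookup S v
  ...   | true  = signal-dist-≤-pred G t v≢w
  ...   | false = z≤n

  reception-self-≥ : ∀ t S {w} → lookup S w ≡ true → t ≤ reception G t S w
  reception-self-≥ t S {w} w∈S = ≤-trans (≤-reflexive (sym self)) (sumFin-≥ (contribution t S w) w)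
    where
    self : contribution t S w w ≡ t
    self rewrite w∈S | dist-refl G w = refl

  reception-outside-≤ : ∀ t S {w} → lookup S w ≡ false → reception G t S w ≤ (t ∸ 1) * ∣ S ∣
  reception-outside-≤ t S w∉S = sumFin-≤-*∣∣ S _ (t ∸ 1) (contribution-outside-≤ t S w∉S)

  reception-single-source-≤ : ∀ t S {w} c → lookup S w ≡ false →
    (∀ v → v ≢ c → v ≢ w → Unreachable v w) → reception G t S w ≤ t ∸ 1
  reception-single-source-≤ t S {w} c w∉S only-c =
    begin
      reception G t S w                 ≡⟨ sumFin-single (contribution t S w) c silent ⟩
      contribution t S w c              ≤⟨ contribution-outside-≤ t S w∉S c ⟩
      (if lookup S c then t ∸ 1 else 0) ≤⟨ if-≤ (lookup S c) ⟩
      t ∸ 1                             ∎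
    where
    open ≤-Reasoning
    silent : ∀ v → v ≢ c → contribution t S w v ≡ 0
    silent v v≢c with v ≟ᶠ w
    ... | yes refl = contribution-∉ t S w∉S
    ... | no v≢w   = contribution-unreachable t S (only-c v v≢c v≢w)
    if-≤ : ∀ b → (if b then t ∸ 1 else 0) ≤ t ∸ 1
    if-≤ true  = ≤-refl
    if-≤ false = z≤n

  ⊤-dominating : ∀ {t r} → r ≤ t → IsBroadcastDominating G t r ⊤
  ⊤-dominating {t} r≤t w = ≤-trans r≤t (reception-self-≥ t ⊤ (lookup-replicate w inside))

  dominating-∣∣≥2 : ∀ {t} S → 2 ≤ N → 0 < t → IsBroadcastDominating G t t S → 2 ≤ ∣ S ∣
  dominating-∣∣≥2 {t} S 2≤N 0<t dom with all? (λ w → lookup S w ≟ᵇ true)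
  ... | yes all∈ = ≤-trans 2≤N (∀∈⇒n≤∣p∣ S all∈)
  ... | no ¬all∈ with ¬∀⟶∃¬ N _ (λ w → lookup S w ≟ᵇ true) ¬all∈
  ...   | w , w∉S = m≤[m∸1]*n⇒2≤n 0<t (≤-trans (dom w) (reception-outside-≤ t S (¬-not w∉S)))

  broadcastDomNumber-exists : ∀ {t r} S₀ → IsBroadcastDominating G t r S₀ →
    ∃ λ k → IsBroadcastDomNumber G t r k × k ≤ ∣ S₀ ∣
  broadcastDomNumber-exists {t} {r} S₀ dom₀
    with least-witness HasDominatingSetOfSize? (<-wellFounded ∣ S₀ ∣) (S₀ , dom₀ , refl)
    where
    HasDominatingSetOfSize : ℕ → Set
    HasDominatingSetOfSize k = Σ (Subset N) λ S → IsBroadcastDominating G t r S × ∣ S ∣ ≡ k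
    HasDominatingSetOfSize? : Decidable HasDominatingSetOfSize
    HasDominatingSetOfSize? k =
      anySubset? (λ S → all? (λ w → r ≤? reception G t S w) ×-dec (∣ S ∣ ≟ k))
  ... | k , has-k , least =
    k , (has-k , λ S dom → least ∣ S ∣ (S , dom , refl)) , least ∣ S₀ ∣ (S₀ , dom₀ , refl)

allOut : ∀ {m} → StarOrientation m
allOut _ = true

allOut-noArcFromLeaf : ∀ {m} (x : Fin m) w → starArc allOut (suc x) w ≡ false
allOut-noArcFromLeaf x zero    = refl
allOut-noArcFromLeaf x (suc w) = refl

allOut-unreachable : ∀ {m} {v w : Fin (suc m)} → v ≢ zero → v ≢ w → Unreachable (starArc allOut) v w
allOut-unreachable {v = v} {w} v≢0 v≢w zero = ⌊⌋-false (v ≟ᶠ w) v≢w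
allOut-unreachable {v = v} {w} v≢0 v≢w (suc k) =
  cong₂ _∨_ (allOut-unreachable v≢0 v≢w k) (anyFin-false noStep)
  where
  noStep : ∀ x → reach (starArc allOut) k v x ∧ starArc allOut x w ≡ false
  noStep zero    rewrite allOut-unreachable v≢0 v≢0 k = refl
  noStep (suc x) rewrite allOut-noArcFromLeaf x w = ∧-zeroʳ _

allOut-dominating⇒∀∈ : ∀ {m t} S → 0 < t → IsBroadcastDominating (starArc {m} allOut) t t S →
  ∀ w → lookup S w ≡ true
allOut-dominating⇒∀∈ {t = suc t} S _ dom w with lookup S w in w∈?
... | true  = refl
... | false = contradiction (≤-trans (dom w) heard) (<-irrefl refl)
  where
  heard : reception (starArc allOut) (suc t) S w ≤ t
  heard = reception-single-source-≤ (starArc allOut) (suc t) S zero w∈?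
            (λ v v≢0 v≢w → allOut-unreachable v≢0 v≢w)

firstLeafIn : ∀ {m} → StarOrientation (suc m)
firstLeafIn zero    = false
firstLeafIn (suc _) = true

centreAndFirstLeaf : ∀ {m} → Subset (suc (suc m))
centreAndFirstLeaf = inside ∷ inside ∷ ⊥

∣centreAndFirstLeaf∣≡2 : ∀ m → ∣ centreAndFirstLeaf {m} ∣ ≡ 2
∣centreAndFirstLeaf∣≡2 m = cong (λ k → suc (suc k)) (∣⊥∣≡0 m)

firstLeafIn-dominating : ∀ {m t} → 2 < t →
  IsBroadcastDominating (starArc {suc m} firstLeafIn) t t centreAndFirstLeaf
firstLeafIn-dominating {m} {t} _ zero =
  reception-self-≥ (starArc {suc m} firstLeafIn) t centreAndFirstLeaf {zero} refl
firstLeafIn-dominating {m} {t} _ (suc zero) =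
  reception-self-≥ (starArc {suc m} firstLeafIn) t centreAndFirstLeaf {suc zero} refl
firstLeafIn-dominating {suc m} {t} 2<t (suc (suc i)) =
  begin
    t                     ≤⟨ m≤[m∸1]+[m∸2] 2<t ⟩
    (t ∸ 1) + (t ∸ 2)     ≤⟨ +-mono-≤ fromCentre fromFirstLeaf ⟩
    heard₀ + heard₁       ≤⟨ +-monoʳ-≤ heard₀ (m≤m+n heard₁ _) ⟩
    reception G t centreAndFirstLeaf w ∎
  where
  open ≤-Reasoning
  G = starArc {suc (suc m)} firstLeafIn
  w = suc (suc i)
  centre⇝w : reach G 1 zero w ≡ true
  centre⇝w = reach-step G 0 zero zero w (reach-refl G zero) refl
  firstLeaf⇝w : reach G 2 (suc zero) w ≡ true
  firstLeaf⇝w = reach-step G 1 (suc zero) zero w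
                  (reach-step G 0 (suc zero) (suc zero) zero (reach-refl G (suc zero)) refl) refl
  heard₀ heard₁ : ℕ
  heard₀ = signal t (dist G zero w)
  heard₁ = signal t (dist G (suc zero) w)
  fromCentre : t ∸ 1 ≤ heard₀
  fromCentre = reach⇒signal-dist-≥ G t 1 zero w centre⇝w (s≤s (s≤s z≤n))
  fromFirstLeaf : t ∸ 2 ≤ heard₁
  fromFirstLeaf = reach⇒signal-dist-≥ G t 2 (suc zero) w firstLeaf⇝w (s≤s (s≤s (s≤s z≤n)))

mainTheorem6 : (m t r : ℕ) → 3 ≤ suc m → t ≡ r → 2 < t →
    StarDomInterval m t r 2 (suc m)
mainTheorem6 (suc (suc m)) t r (s≤s (s≤s (s≤s z≤n))) refl 2<t =
  γ-between , (firstLeafIn , γ≡2) , (allOut , γ≡n)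
  where
  n = suc (suc (suc m))
  0<t : 0 < t
  0<t = ≤-trans (s≤s z≤n) 2<t
  2≤n : 2 ≤ n
  2≤n = s≤s (s≤s z≤n)
  γ-between : ∀ o → Σ ℕ λ k → IsBroadcastDomNumber (starArc o) t t k × 2 ≤ k × k ≤ n
  γ-between o with broadcastDomNumber-exists (starArc o) ⊤ (⊤-dominating (starArc o) {t} ≤-refl)
  ... | k , γ@((S , dom , ∣S∣≡k) , _) , k≤∣⊤∣ =
    k , γ , subst (2 ≤_) ∣S∣≡k (dominating-∣∣≥2 (starArc o) S 2≤n 0<t dom)
      , subst (k ≤_) (∣⊤∣≡n n) k≤∣⊤∣
  γ≡2 : IsBroadcastDomNumber (starArc firstLeafIn) t t 2
  γ≡2 = (centreAndFirstLeaf , firstLeafIn-dominating 2<t , ∣centreAndFirstLeaf∣≡2 (suc m))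
      , λ S dom → dominating-∣∣≥2 (starArc firstLeafIn) S 2≤n 0<t dom
  γ≡n : IsBroadcastDomNumber (starArc allOut) t t n
  γ≡n = (⊤ , ⊤-dominating (starArc allOut) {t} ≤-refl , ∣⊤∣≡n n)
      , λ S dom → ∀∈⇒n≤∣p∣ S (allOut-dominating⇒∀∈ S 0<t dom)
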